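{- Let $t\geq 2$ be even and $n\geq 3$. Then \[\operatorname{M}(P_{t}\times K_n)=\operatorname{Z}(P_{t}\times K_n)= (n-2)t.\]
   Context: All graphs are finite, simple and undirected. $P_t$ is the path on $t$ vertices and $K_n$ the complete graph on $n$ vertices. The tensor product $G\times H$ has vertex set $V(G)\times V(H)$, with $(g,h)$ adjacent to $(g',h')$ iff $g\sim g'$ in $G$ and $h\sim h'$ in $H$. For a graph $G$ on vertex set $\{1,\dots,N\}$, $\mathcal{S}(G)$ is the set of real symmetric $N\times N$ matrices $A=[a_{ij}]$ such that for $i\neq j$, $a_{ij}\neq 0$ iff $\{i,j\}$ is an edge of $G$ (diagonal entries are arbitrary); the maximum nullity is $\operatorname{M}(G)=\max\{\operatorname{null} A: A\in\mathcal{S}(G)\}$. Zero forcing: vertices are colored blue or white; if a blue vertex $u$ has exactly one white neighbor $w$, then $w$ is changed to blue. A zero forcing set is a set $B$ of vertices such that, coloring $B$ blue and all others white, repeated application of this rule colors all vertices blue; $\operatorname{Z}(G)$ is the minimum cardinality of a zero forcing set. -}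

module Defs where

open import Level using (0ℓ)
open import Data.Nat using (ℕ; zero; suc; _≤_)
import Data.Nat as ℕ
open import Data.Nat.Properties using (_≟_)
open import Data.Bool using (Bool; true; false; _∧_; not)
open import Data.Fin using (Fin; toℕ; remQuot)
open import Data.Fin.Subset using (Subset; _∈_; _∉_; _∪_; ⁅_⁆; ∣_∣; ⊤)
open import Data.Product using (Σ; ∃; _×_; _,_; proj₁; proj₂)
open import Data.Sum using (_⊎_)
open import Relation.Binary.PropositionalEquality using (_≡_; _≢_)
open import Relation.Binary.Construct.Closure.ReflexiveTransitive using (Star)
open import Relation.Nullary using (¬_; does)
import Data.Fin as F

-- An axiomatisation of the real numbers: a complete ordered field.
-- (agda-stdlib has no real numbers; every model of this record is,
-- classically, isomorphic to ℝ.)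

record RealField : Set₁ where
  infixl 6 _+_
  infixl 7 _*_
  infix  4 _<_ _≤ᵣ_
  field
    Carrier : Set
    0# 1#   : Carrier
    _+_ _*_ : Carrier → Carrier → Carrier
    -_      : Carrier → Carrier
    _<_     : Carrier → Carrier → Set
    +-assoc     : ∀ x y z → (x + y) + z ≡ x + (y + z)
    +-comm      : ∀ x y → x + y ≡ y + x
    +-identityˡ : ∀ x → 0# + x ≡ x
    -‿inverseˡ  : ∀ x → (- x) + x ≡ 0#
    *-assoc     : ∀ x y z → (x * y) * z ≡ x * (y * z)
    *-comm      : ∀ x y → x * y ≡ y * x
    *-identityˡ : ∀ x → 1# * x ≡ x
    distribˡ    : ∀ x y z → x * (y + z) ≡ x * y + x * z
    0≢1         : 0# ≢ 1#
    *-inverse   : ∀ x → x ≢ 0# → ∃ λ y → x * y ≡ 1#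
    <-irrefl    : ∀ x → ¬ (x < x)
    <-trans     : ∀ {x y z} → x < y → y < z → x < z
    <-trichot   : ∀ x y → x < y ⊎ x ≡ y ⊎ y < x
    +-mono-<    : ∀ {x y} z → x < y → x + z < y + z
    *-pos       : ∀ {x y} → 0# < x → 0# < y → 0# < x * y

  _≤ᵣ_ : Carrier → Carrier → Set
  x ≤ᵣ y = x < y ⊎ x ≡ y

  field
    sup : (P : Carrier → Set) → ∃ P → (∃ λ b → ∀ x → P x → x ≤ᵣ b) →
          ∃ λ s → (∀ x → P x → x ≤ᵣ s) ×
                  (∀ b → (∀ x → P x → x ≤ᵣ b) → s ≤ᵣ b)

Graph : ℕ → Set
Graph N = Fin N → Fin N → Bool

Path : (t : ℕ) → Graph t
Path t i j = does (toℕ i ≟ suc (toℕ j)) Data.Bool.∨ does (toℕ j ≟ suc (toℕ i))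

Complete : (n : ℕ) → Graph n
Complete n i j = not (does (i F.≟ j))

-- tensor product; vertex (g , h) is encoded as  combine g h : Fin (m * n)
_⊗_ : ∀ {m n} → Graph m → Graph n → Graph (m ℕ.* n)
_⊗_ {m} {n} G H x y =
  let (g , h)   = remQuot {m} n x
      (g' , h') = remQuot {m} n y
  in G g g' ∧ H h h'

_~[_]_ : ∀ {N} → Fin N → Graph N → Fin N → Set
i ~[ G ] j = G i j ≡ true

module Nullity (ℝ : RealField) where
  open RealField ℝ

  Σ[_] : ∀ {k} → (Fin k → Carrier) → Carrier
  Σ[_] {zero}  f = 0#
  Σ[_] {suc k} f = f F.zero + Σ[ (λ i → f (F.suc i)) ]

  Matrix : ℕ → Set
  Matrix N = Fin N → Fin N → Carrier

  Vector : ℕ → Set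
  Vector N = Fin N → Carrier

  InKernel : ∀ {N} → Matrix N → Vector N → Set
  InKernel A x = ∀ i → Σ[ (λ j → A i j * x j) ] ≡ 0#

  LinearlyIndependent : ∀ {N k} → (Fin k → Vector N) → Set
  LinearlyIndependent {N} {k} v =
    ∀ (c : Fin k → Carrier) → (∀ j → Σ[ (λ i → c i * v i j) ] ≡ 0#) → ∀ i → c i ≡ 0#

  NullityAtLeast : ∀ {N} → Matrix N → ℕ → Set
  NullityAtLeast {N} A k =
    Σ (Fin k → Vector N) λ v → (∀ i → InKernel A (v i)) × LinearlyIndependent v

  InS : ∀ {N} → Graph N → Matrix N → Set
  InS G A = (∀ i j → A i j ≡ A j i) ×
            (∀ i j → i ≢ j → (A i j ≢ 0# → i ~[ G ] j) × (i ~[ G ] j → A i j ≢ 0#))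

  MaxNullityIs : ∀ {N} → Graph N → ℕ → Set
  MaxNullityIs G k =
    (Σ _ λ A → InS G A × NullityAtLeast A k) ×
    (∀ A → InS G A → ∀ m → NullityAtLeast A m → m ≤ k)

data ForceStep {N} (G : Graph N) : Subset N → Subset N → Set where
  force : ∀ {S} u w → u ∈ S → w ∉ S → u ~[ G ] w →
          (∀ v → u ~[ G ] v → v ∉ S → v ≡ w) →
          ForceStep G S (S ∪ ⁅ w ⁆)

IsZeroForcingSet : ∀ {N} → Graph N → Subset N → Set
IsZeroForcingSet G B = Star (ForceStep G) B ⊤

ZeroForcingNumberIs : ∀ {N} → Graph N → ℕ → Set
ZeroForcingNumberIs G k =
  (Σ _ λ B → IsZeroForcingSet G B × ∣ B ∣ ≡ k) ×
  (∀ B → IsZeroForcingSet G B → k ≤ ∣ B ∣)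

-- If A ∈ S(G), Ax = 0 and x vanishes on a zero forcing set, then x = 0, because
-- a force u → w turns (Ax)_u = 0 into A_uw x_w = 0.  Hence null vectors that are independent remain
-- independent when restricted to the forcing set, whose size therefore bounds the nullity.
--
-- Let B be the signed adjacency matrix of P_t (B_gg′ = ±1 on edges, skew-symmetric) and
-- S_hh′ = h′ − h.  Both are skew, so B ⊗ S is symmetric, with the pattern of P_t × K_n.  Every column of
-- S is an affine combination of the first two; each of these n − 2 column relations, placed in any of the
-- t row blocks, gives a null vector of B ⊗ S, and these (n − 2) t vectors are independent.
--
-- Leave columns 0, 1 white on the even rows and columns 1, 2 white on the odd
-- rows.  Four sweeps along the path make everything blue: column 1 of the odd rows upwards, column 1 of
-- the even rows downwards, column 2 of the odd rows upwards and column 0 of the even rows downwards.  The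
-- downward sweeps start at the last row, which is odd because t is even.  The sweeps are recorded as the
-- time at which each vertex turns blue: the vertices of time 0 form a zero forcing set as soon as every
-- vertex w of positive time has a neighbour u such that u and all neighbours of u other than w come
-- earlier.

module Submission where

open import Defs
open import Level using (0ℓ)
open import Algebra.Bundles using (Monoid; Semiring; CommutativeRing)
open import Data.Bool using (Bool; true; false; _∧_)
open import Data.Fin as Fin
  using (Fin; zero; suc; toℕ; fromℕ<; punchIn; remQuot; combine; _↑ˡ_; _↑ʳ_)
open import Data.Fin.Patterns using (0F; 1F; 2F)
open import Data.Fin.Properties
  using ( all?; any?; ¬∀⟶∃¬; punchInᵢ≢i; toℕ<n; toℕ-fromℕ<; toℕ-injective
        ; remQuot-combine; combine-remQuot)
open import Data.Fin.Subset using (Subset; inside; outside; _∈_; _∉_; _∪_; ⁅_⁆; ∣_∣; ⊤)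
open import Data.Fin.Subset.Properties
  using (_∈?_; x∈p∪q⁻; x∈p∪q⁺; x∈⁅y⁆⇒x≡y; x∈⁅x⁆; ∈⊤; ⊆-antisym)
open import Data.Nat as ℕ using (ℕ; zero; suc; z≤n; s≤s; parity)
import Data.Nat.Properties as ℕ
open import Data.Parity using (Parity; 0ℙ; 1ℙ; _⁻¹)
open import Data.Parity.Properties using (suc-homo-⁻¹; ⁻¹-selfInverse)
open import Data.Product using (∃; _×_; _,_; proj₁; proj₂)
open import Data.Sum using (_⊎_; inj₁; inj₂)
open import Data.Vec using ([]; _∷_; here; there; tabulate)
open import Data.Vec.Properties using (lookup∘tabulate; []=⇒lookup; lookup⇒[]=)
open import Data.Vec.Functional using (Vector; tail; insertAt)
open import Data.Vec.Functional.Properties using (insertAt-lookup; insertAt-punchIn)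
open import Function using (_∘_; _⇔_; mk⇔; Injective)
open import Function.Bundles using (module Equivalence)
open import Relation.Binary.Construct.Closure.ReflexiveTransitive using (Star; ε; _◅_; _◅◅_)
open import Relation.Binary.Definitions using (tri<; tri≈; tri>)
open import Relation.Binary.PropositionalEquality
open import Relation.Nullary using (Dec; yes; no; does; contradiction)
open import Relation.Nullary.Decidable using (¬?; _⊎-dec_; dec-false)

open Equivalence using (to; from)

does≡true⇔ : ∀ {a} {A : Set a} (a? : Dec A) → does a? ≡ true ⇔ A
does≡true⇔ (yes a) = mk⇔ (λ _ → a) (λ _ → refl)
does≡true⇔ (no ¬a) = mk⇔ (λ ()) (λ a → contradiction a ¬a)

∧≡true⇔ : ∀ {a b} → a ∧ b ≡ true ⇔ (a ≡ true × b ≡ true)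
∧≡true⇔ {true}  = mk⇔ (refl ,_) proj₂
∧≡true⇔ {false} = mk⇔ (λ ()) (λ ())

∈-tabulate⇔ : ∀ {N} {f : Fin N → Bool} {x} → x ∈ tabulate f ⇔ f x ≡ true
∈-tabulate⇔ {f = f} {x} = mk⇔ (λ x∈ → trans (sym (lookup∘tabulate f x)) ([]=⇒lookup x∈))
                               (λ fx≡true → lookup⇒[]= x _ (trans (lookup∘tabulate f x) fx≡true))

module Grid (m n : ℕ) where

  row : Fin (m ℕ.* n) → Fin m
  row x = proj₁ (remQuot {m} n x)

  col : Fin (m ℕ.* n) → Fin n
  col x = proj₂ (remQuot {m} n x)

  row-combine : ∀ i j → row (combine i j) ≡ i
  row-combine i j = cong proj₁ (remQuot-combine {m} {n} i j)

  col-combine : ∀ i j → col (combine i j) ≡ j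
  col-combine i j = cong proj₂ (remQuot-combine {m} {n} i j)

  row-col-injective : ∀ {x y} → row x ≡ row y → col x ≡ col y → x ≡ y
  row-col-injective {x} {y} rx≡ry cx≡cy = begin
    x                        ≡⟨ combine-remQuot {m} n x ⟨
    combine (row x) (col x)  ≡⟨ cong₂ combine rx≡ry cx≡cy ⟩
    combine (row y) (col y)  ≡⟨ combine-remQuot {m} n y ⟩
    y                        ∎
    where open ≡-Reasoning

Adjacentℕ : ℕ → ℕ → Set
Adjacentℕ r r′ = r ≡ suc r′ ⊎ r′ ≡ suc r

⊗-adjacent⇔ : ∀ {m n} {G : Graph m} {H : Graph n} {x y} → let open Grid m n in
              x ~[ G ⊗ H ] y ⇔ (row x ~[ G ] row y × col x ~[ H ] col y)
⊗-adjacent⇔ = ∧≡true⇔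

path-adjacent⇔ : ∀ {t} {g g′ : Fin t} → g ~[ Path t ] g′ ⇔ Adjacentℕ (toℕ g) (toℕ g′)
path-adjacent⇔ {g = g} {g′} =
  does≡true⇔ (toℕ g ℕ.≟ suc (toℕ g′) ⊎-dec toℕ g′ ℕ.≟ suc (toℕ g))

complete-adjacent⇔ : ∀ {n} {h h′ : Fin n} → h ~[ Complete n ] h′ ⇔ h ≢ h′
complete-adjacent⇔ {h = h} {h′} = does≡true⇔ (¬? (h Fin.≟ h′))

parity[1+n]≡parity[n]⁻¹ : ∀ n → parity (suc n) ≡ parity n ⁻¹
parity[1+n]≡parity[n]⁻¹ n = sym (⁻¹-selfInverse (suc-homo-⁻¹ n))

parity-adjacent : ∀ {r r′} → Adjacentℕ r r′ → parity r′ ≡ parity r ⁻¹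
parity-adjacent {r′ = r′} (inj₁ refl) = sym (suc-homo-⁻¹ r′)
parity-adjacent {r}       (inj₂ refl) = parity[1+n]≡parity[n]⁻¹ r

odd[1+n]⇒even[n] : ∀ {n} → parity (suc n) ≡ 1ℙ → parity n ≡ 0ℙ
odd[1+n]⇒even[n] {n} odd[1+n] = trans (sym (suc-homo-⁻¹ n)) (cong _⁻¹ odd[1+n])

even[n]⇒odd[1+n] : ∀ {n} → parity n ≡ 0ℙ → parity (suc n) ≡ 1ℙ
even[n]⇒odd[1+n] {n} even[n] = trans (parity[1+n]≡parity[n]⁻¹ n) (cong _⁻¹ even[n])

parity[n*2]≡0ℙ : ∀ q → parity (q ℕ.* 2) ≡ 0ℙ
parity[n*2]≡0ℙ zero    = refl
parity[n*2]≡0ℙ (suc q) = parity[n*2]≡0ℙ q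

even<even⇒1+< : ∀ {r t} → parity r ≡ 0ℙ → parity t ≡ 0ℙ → r ℕ.< t → suc r ℕ.< t
even<even⇒1+< {r} even-r even-t r<t =
  ℕ.≤∧≢⇒< r<t λ { refl → contradiction (trans (sym even-t) (even[n]⇒odd[1+n] {r} even-r)) λ () }

module MonoidSum {c ℓ} (M : Monoid c ℓ) where
  open Monoid M using (Carrier; _≈_; _∙_; identityˡ; assoc; ∙-congˡ)
    renaming (refl to ≈-refl; sym to ≈-sym; trans to ≈-trans)
  open import Algebra.Properties.Monoid.Sum M using (sum)

  sum-splitAt : ∀ a {b} (f : Vector Carrier (a ℕ.+ b)) →
                sum f ≈ sum (f ∘ (_↑ˡ b)) ∙ sum (f ∘ (a ↑ʳ_))
  sum-splitAt zero    f = ≈-sym (identityˡ (sum f))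
  sum-splitAt (suc a) f = ≈-trans (∙-congˡ (sum-splitAt a (f ∘ suc))) (≈-sym (assoc _ _ _))

  sum-combine : ∀ a {b} (f : Vector Carrier (a ℕ.* b)) →
                sum f ≈ sum {a} (λ i → sum {b} (λ j → f (combine i j)))
  sum-combine zero        f = ≈-refl
  sum-combine (suc a) {b} f = ≈-trans (sum-splitAt b f) (∙-congˡ (sum-combine a (f ∘ (b ↑ʳ_))))

module _ where
  open import Algebra.Properties.Monoid.Sum ℕ.+-0-monoid using (sum; sum-cong-≗)
  open MonoidSum ℕ.+-0-monoid using (sum-combine)
  open ≡-Reasoning

  ∣tabulate∣≡sum : ∀ {N} (f : Fin N → Bool) → ∣ tabulate f ∣ ≡ sum (λ i → ∣ f i ∷ [] ∣)
  ∣tabulate∣≡sum {zero}  f = refl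
  ∣tabulate∣≡sum {suc N} f with f zero
  ... | true  = cong suc (∣tabulate∣≡sum (λ i → f (suc i)))
  ... | false = ∣tabulate∣≡sum (λ i → f (suc i))

  sum-const : ∀ t c → sum {t} (λ _ → c) ≡ t ℕ.* c
  sum-const zero    c = refl
  sum-const (suc t) c = cong (c ℕ.+_) (sum-const t c)

  ∣tabulate[true]∣ : ∀ m → ∣ tabulate {m} (λ _ → true) ∣ ≡ m
  ∣tabulate[true]∣ m =
    trans (∣tabulate∣≡sum {m} (λ _ → true)) (trans (sum-const m 1) (ℕ.*-identityʳ m))

  ∣tabulate∣-rows : ∀ t n (f : Fin t → Fin n → Bool) {c} → (∀ g → ∣ tabulate (f g) ∣ ≡ c) →
                    ∣ tabulate (λ x → f (Grid.row t n x) (Grid.col t n x)) ∣ ≡ t ℕ.* c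
  ∣tabulate∣-rows t n f {c} ∣f[g]∣≡c = begin
    ∣ tabulate (λ x → f (row x) (col x)) ∣
      ≡⟨ ∣tabulate∣≡sum (λ x → f (row x) (col x)) ⟩
    sum (λ x → ∣ f (row x) (col x) ∷ [] ∣)
      ≡⟨ sum-combine t (λ x → ∣ f (row x) (col x) ∷ [] ∣) ⟩
    sum {t} (λ g → sum {n} (λ h → ∣ f (row (combine g h)) (col (combine g h)) ∷ [] ∣))
      ≡⟨ sum-cong-≗ (λ g → sum-cong-≗ (λ h →
           cong₂ (λ g′ h′ → ∣ f g′ h′ ∷ [] ∣) (row-combine g h) (col-combine g h))) ⟩
    sum {t} (λ g → sum {n} (λ h → ∣ f g h ∷ [] ∣))
      ≡⟨ sum-cong-≗ (λ g → sym (∣tabulate∣≡sum (f g))) ⟩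
    sum {t} (λ g → ∣ tabulate (f g) ∣)
      ≡⟨ sum-cong-≗ ∣f[g]∣≡c ⟩
    sum {t} (λ _ → c)
      ≡⟨ sum-const t c ⟩
    t ℕ.* c
      ∎
    where open Grid t n

module OrderedField (ℝ : RealField) where
  open RealField ℝ
  open ≡-Reasoning

  commutativeRing : CommutativeRing 0ℓ 0ℓ
  commutativeRing = record
    { isCommutativeRing = record
      { isRing = record
        { +-isAbelianGroup = record
          { isGroup = record
            { isMonoid = record
              { isSemigroup = record
                { isMagma = record { isEquivalence = isEquivalence ; ∙-cong = cong₂ _+_ }
                ; assoc = +-assoc }
              ; identity = +-identityˡ , λ x → trans (+-comm x 0#) (+-identityˡ x) }
            ; inverse = -‿inverseˡ , λ x → trans (+-comm x (- x)) (-‿inverseˡ x)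
            ; ⁻¹-cong = cong -_ }
          ; comm = +-comm }
        ; *-cong = cong₂ _*_
        ; *-assoc = *-assoc
        ; *-identity = *-identityˡ , λ x → trans (*-comm x 1#) (*-identityˡ x)
        ; distrib = distribˡ , λ x y z → begin
            (y + z) * x     ≡⟨ *-comm (y + z) x ⟩
            x * (y + z)     ≡⟨ distribˡ x y z ⟩
            x * y + x * z   ≡⟨ cong₂ _+_ (*-comm x y) (*-comm x z) ⟩
            y * x + z * x   ∎ }
      ; *-comm = *-comm } }

  open CommutativeRing commutativeRing public
    using ( +-identityʳ; -‿inverseʳ; *-identityʳ; distribʳ; zeroˡ; zeroʳ
          ; semiring; ring; +-abelianGroup; *-commutativeSemigroup)
  open import Algebra.Properties.Ring ring public using (-‿distribˡ-*; -‿distribʳ-*)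
  open import Algebra.Properties.AbelianGroup +-abelianGroup public
    using (⁻¹-involutive; ⁻¹-∙-comm; x∙y⁻¹≈ε⇒x≈y; ε⁻¹≈ε)
  open import Algebra.Properties.Semiring.Sum semiring public
    using ( sum; sum-cong-≗; ∑-distrib-+; ∑-comm; *-distribˡ-sum; *-distribʳ-sum
          ; sum-remove; sum-replicate-zero)

  Σ≡sum : ∀ {k} (f : Vector Carrier k) → Nullity.Σ[_] ℝ f ≡ sum f
  Σ≡sum {zero}  f = refl
  Σ≡sum {suc k} f = cong (f zero +_) (Σ≡sum (λ i → f (suc i)))

  _≟0 : ∀ x → Dec (x ≡ 0#)
  x ≟0 with <-trichot x 0#
  ... | inj₁ x<0        = no λ x≡0 → <-irrefl 0# (subst (_< 0#) x≡0 x<0)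
  ... | inj₂ (inj₁ x≡0) = yes x≡0
  ... | inj₂ (inj₂ 0<x) = no λ x≡0 → <-irrefl 0# (subst (0# <_) x≡0 0<x)

  x≢0⇒x*y≡0⇒y≡0 : ∀ {x y} → x ≢ 0# → x * y ≡ 0# → y ≡ 0#
  x≢0⇒x*y≡0⇒y≡0 {x} {y} x≢0 xy≡0 with *-inverse x x≢0
  ... | x⁻¹ , xx⁻¹≡1 = begin
    y                ≡⟨ *-identityˡ y ⟨
    1# * y           ≡⟨ cong (_* y) (trans (sym xx⁻¹≡1) (*-comm x x⁻¹)) ⟩
    (x⁻¹ * x) * y    ≡⟨ *-assoc x⁻¹ x y ⟩
    x⁻¹ * (x * y)    ≡⟨ cong (x⁻¹ *_) xy≡0 ⟩
    x⁻¹ * 0#         ≡⟨ zeroʳ x⁻¹ ⟩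
    0#               ∎

  x≢0∧y≢0⇒x*y≢0 : ∀ {x y} → x ≢ 0# → y ≢ 0# → x * y ≢ 0#
  x≢0∧y≢0⇒x*y≢0 x≢0 y≢0 xy≡0 = y≢0 (x≢0⇒x*y≡0⇒y≡0 x≢0 xy≡0)

  -x≢0 : ∀ {x} → x ≢ 0# → - x ≢ 0#
  -x≢0 {x} x≢0 -x≡0 = x≢0 (begin
    x        ≡⟨ ⁻¹-involutive x ⟨
    - (- x)  ≡⟨ cong -_ -x≡0 ⟩
    - 0#     ≡⟨ ε⁻¹≈ε ⟩
    0#       ∎)

  0<1 : 0# < 1#
  0<1 with <-trichot 0# 1#
  ... | inj₁ 0<1        = 0<1
  ... | inj₂ (inj₁ 0≡1) = contradiction 0≡1 0≢1
  ... | inj₂ (inj₂ 1<0) =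
    contradiction (<-trans 1<0 (subst (0# <_) -1*-1≡1 (*-pos 0<-1 0<-1))) (<-irrefl 1#)
    where
    0<-1 : 0# < - 1#
    0<-1 = subst₂ _<_ (-‿inverseʳ 1#) (+-identityˡ (- 1#)) (+-mono-< (- 1#) 1<0)
    -1*-1≡1 : - 1# * - 1# ≡ 1#
    -1*-1≡1 = begin
      - 1# * - 1#    ≡⟨ -‿distribˡ-* 1# (- 1#) ⟨
      - (1# * - 1#)  ≡⟨ cong -_ (*-identityˡ (- 1#)) ⟩
      - (- 1#)       ≡⟨ ⁻¹-involutive 1# ⟩
      1#             ∎

  fromℕ : ℕ → Carrier
  fromℕ zero    = 0#
  fromℕ (suc n) = 1# + fromℕ n

  fromℕ[n]<fromℕ[1+n] : ∀ n → fromℕ n < fromℕ (suc n)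
  fromℕ[n]<fromℕ[1+n] n =
    subst (_< 1# + fromℕ n) (+-identityˡ (fromℕ n)) (+-mono-< (fromℕ n) 0<1)

  fromℕ-< : ∀ {m n} → m ℕ.< n → fromℕ m < fromℕ n
  fromℕ-< {m} {suc n} m<1+n with ℕ.m≤n⇒m<n∨m≡n (ℕ.≤-pred m<1+n)
  ... | inj₁ m<n  = <-trans (fromℕ-< m<n) (fromℕ[n]<fromℕ[1+n] n)
  ... | inj₂ refl = fromℕ[n]<fromℕ[1+n] m

  fromℕ-injective : ∀ {m n} → fromℕ m ≡ fromℕ n → m ≡ n
  fromℕ-injective {m} {n} eq with ℕ.<-cmp m n
  ... | tri< m<n _ _ = contradiction (subst (_< fromℕ n) eq (fromℕ-< m<n)) (<-irrefl _)
  ... | tri≈ _ m≡n _ = m≡n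
  ... | tri> _ _ n<m = contradiction (subst (fromℕ n <_) eq (fromℕ-< n<m)) (<-irrefl _)

-- Maximum nullity is at most the zero forcing number

module LinearAlgebra (ℝ : RealField) where
  open RealField ℝ
  open OrderedField ℝ
  open Nullity ℝ using (Matrix; InKernel; InS; NullityAtLeast)
  open import Algebra.Properties.CommutativeSemigroup *-commutativeSemigroup using (x∙yz≈y∙xz)
  open ≡-Reasoning

  sum-single : ∀ {k} {f : Vector Carrier k} i → (∀ j → j ≢ i → f j ≡ 0#) → sum f ≡ f i
  sum-single {suc k} {f} i f≡0 = begin
    sum f
      ≡⟨ sum-remove {i = i} f ⟩
    f i + sum (f ∘ punchIn i)
      ≡⟨ cong (f i +_) (sum-cong-≗ (λ j → f≡0 (punchIn i j) (punchInᵢ≢i i j))) ⟩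
    f i + sum {k} (λ _ → 0#)
      ≡⟨ cong (f i +_) (sum-replicate-zero k) ⟩
    f i + 0#
      ≡⟨ +-identityʳ (f i) ⟩
    f i
      ∎

  sum-zero : ∀ {k} {f : Vector Carrier k} → (∀ i → f i ≡ 0#) → sum f ≡ 0#
  sum-zero {k} f≡0 = trans (sum-cong-≗ f≡0) (sum-replicate-zero k)

  inKernel⇔ : ∀ {N} {A : Matrix N} {x} → InKernel A x ⇔ (∀ i → sum (λ j → A i j * x j) ≡ 0#)
  inKernel⇔ {A = A} {x} = mk⇔ (λ Ax≡0 i → trans (sym (Σ≡sum (λ j → A i j * x j))) (Ax≡0 i))
                              (λ Ax≡0 i → trans (Σ≡sum (λ j → A i j * x j)) (Ax≡0 i))

  VanishesOn : ∀ {N} → Vector Carrier N → Subset N → Set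
  VanishesOn x S = ∀ j → j ∈ S → x j ≡ 0#

  vanishesOn-forceStep : ∀ {N} {G : Graph N} {A x S S′} → InS G A → InKernel A x →
                         ForceStep G S S′ → VanishesOn x S → VanishesOn x S′
  vanishesOn-forceStep {A = A} {x} (_ , A-pattern) Ax≡0 (force {S} u w u∈S w∉S u~w w-unique) x|S≡0 j j∈
    with x∈p∪q⁻ S ⁅ w ⁆ j∈
  ... | inj₁ j∈S = x|S≡0 j j∈S
  ... | inj₂ j∈⁅w⁆ rewrite x∈⁅y⁆⇒x≡y w j∈⁅w⁆ =
    x≢0⇒x*y≡0⇒y≡0 (proj₂ (A-pattern u w (u≢ w∉S)) u~w)
      (trans (sym (sum-single w others)) (to inKernel⇔ Ax≡0 u))
    where
    u≢ : ∀ {j} → j ∉ S → u ≢ j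
    u≢ j∉S refl = j∉S u∈S
    others : ∀ j → j ≢ w → A u j * x j ≡ 0#
    others j j≢w with j ∈? S
    ... | yes j∈S = trans (cong (A u j *_) (x|S≡0 j j∈S)) (zeroʳ _)
    ... | no j∉S with A u j ≟0
    ...   | yes Auj≡0 = trans (cong (_* x j) Auj≡0) (zeroˡ _)
    ...   | no Auj≢0 = contradiction (w-unique j (proj₁ (A-pattern u j (u≢ j∉S)) Auj≢0) j∉S) j≢w

  vanishesOn-zeroForcingSet : ∀ {N} {G : Graph N} {A x B} → InS G A → InKernel A x →
                              IsZeroForcingSet G B → VanishesOn x B → ∀ j → x j ≡ 0#
  vanishesOn-zeroForcingSet _ _ ε x|⊤≡0 j = x|⊤≡0 j ∈⊤
  vanishesOn-zeroForcingSet A∈S Ax≡0 (step ◅ steps) x|B≡0 =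
    vanishesOn-zeroForcingSet A∈S Ax≡0 steps (vanishesOn-forceStep A∈S Ax≡0 step x|B≡0)

  LinearlyIndependentOn : ∀ {N m} → Subset N → (Fin m → Vector Carrier N) → Set
  LinearlyIndependentOn {m = m} B v =
    ∀ (c : Vector Carrier m) → VanishesOn (λ j → sum (λ i → c i * v i j)) B → ∀ i → c i ≡ 0#

  independentOn-tail : ∀ {N m s} {B : Subset N} {v : Fin m → Vector Carrier (suc N)} →
                       (s ≡ inside → ∀ i → v i zero ≡ 0#) →
                       LinearlyIndependentOn (s ∷ B) v → LinearlyIndependentOn B (tail ∘ v)
  independentOn-tail v·0≡0 ind c hyp = ind c λ
    { zero here → sum-zero (λ i → trans (cong (c i *_) (v·0≡0 refl i)) (zeroʳ (c i)))
    ; (suc j) (there j∈B) → hyp j j∈B }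

  module PivotElimination {N m} (v : Fin (suc m) → Vector Carrier (suc N))
                          (i₀ : Fin (suc m)) (q : Carrier) (pq≡1 : v i₀ zero * q ≡ 1#) where

    reduced : Fin m → Vector Carrier N
    reduced k j = v (punchIn i₀ k) (suc j) + v (punchIn i₀ k) zero * (- q * v i₀ (suc j))

    reduced-independentOn : ∀ {B} → LinearlyIndependentOn (inside ∷ B) v →
                            LinearlyIndependentOn B reduced
    reduced-independentOn {B} ind c c·reduced|B≡0 k =
      trans (sym (insertAt-punchIn c i₀ d k)) (ind c′ c′·v|B≡0 (punchIn i₀ k))
      where
      σ = sum (λ k → c k * v (punchIn i₀ k) zero)
      d = σ * - q
      c′ = insertAt c i₀ d

      split : ∀ j → sum (λ i → c′ i * v i j) ≡ d * v i₀ j + sum (λ k → c k * v (punchIn i₀ k) j)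
      split j = trans (sum-remove {i = i₀} (λ i → c′ i * v i j))
        (cong₂ _+_ (cong (_* v i₀ j) (insertAt-lookup c i₀ d))
                   (sum-cong-≗ (λ k → cong (_* v (punchIn i₀ k) j) (insertAt-punchIn c i₀ d k))))

      pivot-column : d * v i₀ zero + σ ≡ 0#
      pivot-column = begin
        (σ * - q) * v i₀ zero + σ  ≡⟨ cong (_+ σ) (*-assoc σ (- q) _) ⟩
        σ * (- q * v i₀ zero) + σ  ≡⟨ cong (λ z → σ * z + σ) (-‿distribˡ-* q _) ⟨
        σ * - (q * v i₀ zero) + σ  ≡⟨ cong (λ z → σ * - z + σ) (trans (*-comm q _) pq≡1) ⟩
        σ * - 1# + σ               ≡⟨ cong (_+ σ) (-‿distribʳ-* σ 1#) ⟨
        - (σ * 1#) + σ             ≡⟨ cong (λ z → - z + σ) (*-identityʳ σ) ⟩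
        - σ + σ                    ≡⟨ -‿inverseˡ σ ⟩
        0#                         ∎

      other-column : ∀ j → d * v i₀ (suc j) + sum (λ k → c k * v (punchIn i₀ k) (suc j)) ≡
                           sum (λ k → c k * reduced k j)
      other-column j = begin
        d * y + sum (λ k → c k * u k)
          ≡⟨ cong (_+ sum (λ k → c k * u k)) (*-assoc σ (- q) y) ⟩
        σ * r + sum (λ k → c k * u k)
          ≡⟨ +-comm (σ * r) _ ⟩
        sum (λ k → c k * u k) + σ * r
          ≡⟨ cong (sum (λ k → c k * u k) +_) (*-distribʳ-sum r (λ k → c k * a k)) ⟩
        sum (λ k → c k * u k) + sum (λ k → (c k * a k) * r)
          ≡⟨ ∑-distrib-+ (λ k → c k * u k) (λ k → (c k * a k) * r) ⟨
        sum (λ k → c k * u k + (c k * a k) * r)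
          ≡⟨ sum-cong-≗ (λ k → cong (c k * u k +_) (*-assoc (c k) (a k) r)) ⟩
        sum (λ k → c k * u k + c k * (a k * r))
          ≡⟨ sum-cong-≗ (λ k → distribˡ (c k) (u k) _) ⟨
        sum (λ k → c k * reduced k j)
          ∎
        where
        y = v i₀ (suc j)
        r = - q * y
        u a : Fin m → Carrier
        u k = v (punchIn i₀ k) (suc j)
        a k = v (punchIn i₀ k) zero

      c′·v|B≡0 : VanishesOn (λ j → sum (λ i → c′ i * v i j)) (inside ∷ B)
      c′·v|B≡0 zero    _           = trans (split zero) pivot-column
      c′·v|B≡0 (suc j) (there j∈B) =
        trans (split (suc j)) (trans (other-column j) (c·reduced|B≡0 j j∈B))

  independentOn⇒m≤∣B∣ : ∀ {N m} (B : Subset N) (v : Fin m → Vector Carrier N) →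
                        LinearlyIndependentOn B v → m ℕ.≤ ∣ B ∣
  independentOn⇒m≤∣B∣ {m = zero}  B  v ind = z≤n
  independentOn⇒m≤∣B∣ {m = suc m} [] v ind = contradiction (sym (ind (λ _ → 1#) (λ ()) zero)) 0≢1
  independentOn⇒m≤∣B∣ (outside ∷ B) v ind =
    independentOn⇒m≤∣B∣ B (tail ∘ v) (independentOn-tail {B = B} {v} (λ ()) ind)
  independentOn⇒m≤∣B∣ {m = suc m} (inside ∷ B) v ind with all? (λ i → v i zero ≟0)
  ... | yes v·0≡0 = ℕ.m≤n⇒m≤1+n
    (independentOn⇒m≤∣B∣ B (tail ∘ v) (independentOn-tail {B = B} {v} (λ _ → v·0≡0) ind))
  ... | no ¬v·0≡0 with ¬∀⟶∃¬ _ _ (λ i → v i zero ≟0) ¬v·0≡0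
  ...   | i₀ , p≢0 with *-inverse (v i₀ zero) p≢0
  ...     | q , pq≡1 = s≤s (independentOn⇒m≤∣B∣ B reduced (reduced-independentOn ind))
    where open PivotElimination v i₀ q pq≡1

  combination-inKernel : ∀ {N m} {A} {v : Fin m → Vector Carrier N} → (∀ i → InKernel A (v i)) →
                         ∀ (c : Vector Carrier m) → InKernel A (λ j → sum (λ i → c i * v i j))
  combination-inKernel {A = A} {v} Av≡0 c = from inKernel⇔ λ u → begin
    sum (λ j → A u j * sum (λ i → c i * v i j))
      ≡⟨ sum-cong-≗ (λ j → *-distribˡ-sum (A u j) (λ i → c i * v i j)) ⟩
    sum (λ j → sum (λ i → A u j * (c i * v i j)))
      ≡⟨ ∑-comm (λ j i → A u j * (c i * v i j)) ⟩
    sum (λ i → sum (λ j → A u j * (c i * v i j)))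
      ≡⟨ sum-cong-≗ (λ i → sum-cong-≗ (λ j → x∙yz≈y∙xz (A u j) (c i) (v i j))) ⟩
    sum (λ i → sum (λ j → c i * (A u j * v i j)))
      ≡⟨ sum-cong-≗ (λ i → *-distribˡ-sum (c i) (λ j → A u j * v i j)) ⟨
    sum (λ i → c i * sum (λ j → A u j * v i j))
      ≡⟨ sum-zero (λ i → trans (cong (c i *_) (to inKernel⇔ (Av≡0 i) u)) (zeroʳ (c i))) ⟩
    0#
      ∎

  maxNullity≤zeroForcing : ∀ {N} {G : Graph N} {A m B} → InS G A → NullityAtLeast A m →
                           IsZeroForcingSet G B → m ℕ.≤ ∣ B ∣
  maxNullity≤zeroForcing {B = B} A∈S (v , Av≡0 , v-independent) B-forces =
    independentOn⇒m≤∣B∣ B v λ c c·v|B≡0 → v-independent c λ j →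
      trans (Σ≡sum (λ i → c i * v i j))
            (vanishesOn-zeroForcingSet A∈S (combination-inKernel Av≡0 c) B-forces c·v|B≡0 j)

-- A matrix in S(P_t × K_n) of nullity (n − 2) t

module Construction (ℝ : RealField) where
  open RealField ℝ
  open OrderedField ℝ
  open LinearAlgebra ℝ
  open Nullity ℝ using (Matrix; InKernel; InS; LinearlyIndependent; NullityAtLeast)
  open MonoidSum (Semiring.+-monoid semiring) using (sum-combine)
  open import Algebra.Properties.CommutativeSemigroup *-commutativeSemigroup using (interchange)
  open import Algebra.Properties.CommutativeSemigroup (Semiring.+-commutativeSemigroup semiring)
    using () renaming (interchange to +-interchange)
  open ≡-Reasoning

  SkewPattern : ∀ {N} → Graph N → Matrix N → Set
  SkewPattern G B = (∀ i j → B j i ≡ - B i j) × (∀ i j → B i j ≢ 0# ⇔ i ~[ G ] j)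

  module Kronecker (m n : ℕ) where
    open Grid m n

    _⊗ₘ_ : Matrix m → Matrix n → Matrix (m ℕ.* n)
    (B ⊗ₘ C) x y = B (row x) (row y) * C (col x) (col y)

    _⊗ᵥ_ : Vector Carrier m → Vector Carrier n → Vector Carrier (m ℕ.* n)
    (u ⊗ᵥ z) x = u (row x) * z (col x)

    ⊗ₘ-inS : ∀ {G : Graph m} {H : Graph n} {B C} → SkewPattern G B → SkewPattern H C →
             InS (G ⊗ H) (B ⊗ₘ C)
    ⊗ₘ-inS {G} {H} {B} {C} (B-skew , B≢0⇔~) (C-skew , C≢0⇔~) = symmetric , λ x y _ →
      (λ BC≢0 → from (⊗-adjacent⇔ {G = G} {H} {x} {y})
         (to (B≢0⇔~ _ _) (λ B≡0 → BC≢0 (trans (cong (_* _) B≡0) (zeroˡ _))) ,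
          to (C≢0⇔~ _ _) (λ C≡0 → BC≢0 (trans (cong (_ *_) C≡0) (zeroʳ _))))) ,
      (λ x~y → let (g~g′ , h~h′) = to (⊗-adjacent⇔ {G = G} {H} {x} {y}) x~y in
         x≢0∧y≢0⇒x*y≢0 (from (B≢0⇔~ _ _) g~g′) (from (C≢0⇔~ _ _) h~h′))
      where
      symmetric : ∀ x y → (B ⊗ₘ C) x y ≡ (B ⊗ₘ C) y x
      symmetric x y = sym (begin
        B (row y) (row x) * C (col y) (col x)          ≡⟨ cong₂ _*_ (B-skew _ _) (C-skew _ _) ⟩
        - B (row x) (row y) * - C (col x) (col y)      ≡⟨ -‿distribˡ-* _ _ ⟨
        - (B (row x) (row y) * - C (col x) (col y))    ≡⟨ cong -_ (-‿distribʳ-* _ _) ⟨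
        - - (B (row x) (row y) * C (col x) (col y))    ≡⟨ ⁻¹-involutive _ ⟩
        B (row x) (row y) * C (col x) (col y)          ∎)

    ⊗-inKernel : ∀ {B : Matrix m} {C : Matrix n} (u : Vector Carrier m) {z} →
                 InKernel C z → InKernel (B ⊗ₘ C) (u ⊗ᵥ z)
    ⊗-inKernel {B} {C} u {z} Cz≡0 = from inKernel⇔ λ x → begin
      sum (λ y → (B ⊗ₘ C) x y * (u ⊗ᵥ z) y)
        ≡⟨ sum-combine m (λ y → (B ⊗ₘ C) x y * (u ⊗ᵥ z) y) ⟩
      sum {m} (λ g → sum {n} (λ h → (B ⊗ₘ C) x (combine g h) * (u ⊗ᵥ z) (combine g h)))
        ≡⟨ sum-cong-≗ (λ g → sum-cong-≗ (λ h → at-combine x g h)) ⟩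
      sum (λ g → sum (λ h → (B (row x) g * u g) * (C (col x) h * z h)))
        ≡⟨ sum-cong-≗ (λ g → *-distribˡ-sum (B (row x) g * u g) (λ h → C (col x) h * z h)) ⟨
      sum (λ g → (B (row x) g * u g) * sum (λ h → C (col x) h * z h))
        ≡⟨ sum-zero (λ g → trans (cong (B (row x) g * u g *_) (to inKernel⇔ Cz≡0 (col x)))
                                  (zeroʳ _)) ⟩
      0#
        ∎
      where
      at-combine : ∀ x g h → (B ⊗ₘ C) x (combine g h) * (u ⊗ᵥ z) (combine g h) ≡
                             (B (row x) g * u g) * (C (col x) h * z h)
      at-combine x g h rewrite row-combine g h | col-combine g h = interchange _ _ _ _

  signedPath : ∀ {t} → Matrix t
  signedPath g g′ with toℕ g ℕ.≟ suc (toℕ g′) | toℕ g′ ℕ.≟ suc (toℕ g)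
  ... | yes _ | _     = - 1#
  ... | no _  | yes _ = 1#
  ... | no _  | no _  = 0#

  signedPath-skewPattern : ∀ {t} → SkewPattern (Path t) signedPath
  signedPath-skewPattern = skew , λ g g′ →
    mk⇔ (from path-adjacent⇔ ∘ ≢0⇒adjacentℕ g g′) (adjacentℕ⇒≢0 g g′ ∘ to path-adjacent⇔)
    where
    skew : ∀ g g′ → signedPath g′ g ≡ - signedPath g g′
    skew g g′ with toℕ g ℕ.≟ suc (toℕ g′) | toℕ g′ ℕ.≟ suc (toℕ g)
    ... | yes p | yes q = contradiction (trans p (cong suc q)) (ℕ.m≢1+n+m (toℕ g) {1})
    ... | yes _ | no _  = sym (⁻¹-involutive 1#)
    ... | no _  | yes _ = refl
    ... | no _  | no _  = sym ε⁻¹≈ε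
    ≢0⇒adjacentℕ : ∀ g g′ → signedPath g g′ ≢ 0# → Adjacentℕ (toℕ g) (toℕ g′)
    ≢0⇒adjacentℕ g g′ ≢0 with toℕ g ℕ.≟ suc (toℕ g′) | toℕ g′ ℕ.≟ suc (toℕ g)
    ... | yes p | _     = inj₁ p
    ... | no _  | yes q = inj₂ q
    ... | no _  | no _  = contradiction refl ≢0
    adjacentℕ⇒≢0 : ∀ g g′ → Adjacentℕ (toℕ g) (toℕ g′) → signedPath g g′ ≢ 0#
    adjacentℕ⇒≢0 g g′ adj with toℕ g ℕ.≟ suc (toℕ g′) | toℕ g′ ℕ.≟ suc (toℕ g) | adj
    ... | yes _ | _     | _       = -x≢0 (λ 1≡0 → 0≢1 (sym 1≡0))
    ... | no _  | yes _ | _       = λ 1≡0 → 0≢1 (sym 1≡0)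
    ... | no p  | no _  | inj₁ p′ = contradiction p′ p
    ... | no _  | no q  | inj₂ q′ = contradiction q′ q

  difference : ∀ {n} → Vector Carrier n → Matrix n
  difference f h h′ = f h′ + - f h

  difference-skewPattern : ∀ {n} {f : Vector Carrier n} → (∀ {h h′} → f h ≡ f h′ → h ≡ h′) →
                           SkewPattern (Complete n) (difference f)
  difference-skewPattern {f = f} f-injective = skew , λ h h′ → mk⇔
    (λ ≢0 → from (complete-adjacent⇔ {h = h} {h′}) λ { refl → ≢0 (-‿inverseʳ (f h)) })
    (λ h~h′ ≡0 → to (complete-adjacent⇔ {h = h} {h′}) h~h′
                   (sym (f-injective (x∙y⁻¹≈ε⇒x≈y _ _ ≡0))))
    where
    skew : ∀ h h′ → f h + - f h′ ≡ - (f h′ + - f h)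
    skew h h′ = begin
      f h + - f h′      ≡⟨ +-comm (f h) _ ⟩
      - f h′ + f h      ≡⟨ cong (- f h′ +_) (⁻¹-involutive (f h)) ⟨
      - f h′ + - - f h  ≡⟨ ⁻¹-∙-comm (f h′) (- f h) ⟩
      - (f h′ + - f h)  ∎

  difference-inKernel : ∀ {n} {f z : Vector Carrier n} → sum z ≡ 0# → sum (λ h → f h * z h) ≡ 0# →
                        InKernel (difference f) z
  difference-inKernel {f = f} {z} Σz≡0 Σfz≡0 = from inKernel⇔ λ h → begin
    sum (λ h′ → (f h′ + - f h) * z h′)
      ≡⟨ sum-cong-≗ (λ h′ → distribʳ (z h′) (f h′) (- f h)) ⟩
    sum (λ h′ → f h′ * z h′ + - f h * z h′)
      ≡⟨ ∑-distrib-+ (λ h′ → f h′ * z h′) (λ h′ → - f h * z h′) ⟩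
    sum (λ h′ → f h′ * z h′) + sum (λ h′ → - f h * z h′)
      ≡⟨ cong₂ _+_ Σfz≡0 (sym (*-distribˡ-sum (- f h) z)) ⟩
    0# + - f h * sum z
      ≡⟨ cong (λ s → 0# + - f h * s) Σz≡0 ⟩
    0# + - f h * 0#
      ≡⟨ trans (+-identityˡ _) (zeroʳ _) ⟩
    0#
      ∎

  unit : ∀ {n} → Fin n → Vector Carrier n
  unit i j with i Fin.≟ j
  ... | yes _ = 1#
  ... | no _  = 0#

  unit-diag : ∀ {n} (i : Fin n) → unit i i ≡ 1#
  unit-diag i with i Fin.≟ i
  ... | yes _  = refl
  ... | no i≢i = contradiction refl i≢i

  unit-off : ∀ {n} {i j : Fin n} → i ≢ j → unit i j ≡ 0#
  unit-off {i = i} {j} i≢j with i Fin.≟ j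
  ... | yes i≡j = contradiction i≡j i≢j
  ... | no _    = refl

  sum-unit : ∀ {n} (f : Vector Carrier n) i → sum (λ j → f j * unit j i) ≡ f i
  sum-unit f i = begin
    sum (λ j → f j * unit j i)
      ≡⟨ sum-single i (λ j j≢i → trans (cong (f j *_) (unit-off j≢i)) (zeroʳ (f j))) ⟩
    f i * unit i i
      ≡⟨ cong (f i *_) (unit-diag i) ⟩
    f i * 1#
      ≡⟨ *-identityʳ (f i) ⟩
    f i
      ∎

  pivots⇒independent : ∀ {N m} (v : Fin m → Vector Carrier N) (p : Fin m → Fin N) →
                       (∀ k → v k (p k) ≡ 1#) → (∀ k k′ → k′ ≢ k → v k′ (p k) ≡ 0#) →
                       LinearlyIndependent v
  pivots⇒independent v p v-diag v-off c c·v≡0 k = begin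
    c k
      ≡⟨ *-identityʳ (c k) ⟨
    c k * 1#
      ≡⟨ cong (c k *_) (v-diag k) ⟨
    c k * v k (p k)
      ≡⟨ sum-single k (λ k′ k′≢k → trans (cong (c k′ *_) (v-off k k′ k′≢k)) (zeroʳ _)) ⟨
    sum (λ k′ → c k′ * v k′ (p k))
      ≡⟨ trans (sym (Σ≡sum (λ k′ → c k′ * v k′ (p k)))) (c·v≡0 (p k)) ⟩
    0#
      ∎

  fromFin : ∀ {n} → Vector Carrier n
  fromFin h = fromℕ (toℕ h)

  -- Column 2 + j of `difference fromFin` is x · (column 1) + (1 − x) · (column 0), where x = fromFin (2 + j).
  columnRelation : ∀ {m} → Fin m → Vector Carrier (2 ℕ.+ m)
  columnRelation j zero          = fromFin (suc (suc j)) + - 1#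
  columnRelation j (suc zero)    = - fromFin (suc (suc j))
  columnRelation j (suc (suc h)) = unit h j

  columnRelation-inKernel : ∀ {m} (j : Fin m) → InKernel (difference fromFin) (columnRelation j)
  columnRelation-inKernel j = difference-inKernel {z = columnRelation j} Σz≡0 Σfz≡0
    where
    x = fromFin (suc (suc j))
    Σunit≡1 : sum (λ h → unit h j) ≡ 1#
    Σunit≡1 = trans (sum-cong-≗ (λ h → sym (*-identityˡ (unit h j)))) (sum-unit (λ _ → 1#) j)
    Σz≡0 : sum (columnRelation j) ≡ 0#
    Σz≡0 = begin
      (x + - 1#) + (- x + sum (λ h → unit h j))  ≡⟨ cong (λ s → (x + - 1#) + (- x + s)) Σunit≡1 ⟩
      (x + - 1#) + (- x + 1#)                    ≡⟨ +-interchange x (- 1#) (- x) 1# ⟩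
      (x + - x) + (- 1# + 1#)                    ≡⟨ cong₂ _+_ (-‿inverseʳ x) (-‿inverseˡ 1#) ⟩
      0# + 0#                                    ≡⟨ +-identityˡ 0# ⟩
      0#                                         ∎
    Σfz≡0 : sum (λ h → fromFin h * columnRelation j h) ≡ 0#
    Σfz≡0 = begin
      0# * (x + - 1#) + ((1# + 0#) * - x + sum (λ h → fromFin (suc (suc h)) * unit h j))
        ≡⟨ cong₂ (λ a b → a + ((1# + 0#) * - x + b))
                 (zeroˡ _) (sum-unit (λ h → fromFin (suc (suc h))) j) ⟩
      0# + ((1# + 0#) * - x + x)  ≡⟨ +-identityˡ _ ⟩
      (1# + 0#) * - x + x         ≡⟨ cong (λ o → o * - x + x) (+-identityʳ 1#) ⟩
      1# * - x + x                ≡⟨ cong (_+ x) (*-identityˡ (- x)) ⟩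
      - x + x                     ≡⟨ -‿inverseˡ x ⟩
      0#                          ∎

  module _ (t m : ℕ) where
    open Grid t (2 ℕ.+ m)
    open Kronecker t (2 ℕ.+ m)
    open Grid m t using ()
      renaming (row to relationOf; col to blockOf; row-col-injective to relation-block-injective)

    pathTensorComplete : Matrix (t ℕ.* (2 ℕ.+ m))
    pathTensorComplete = signedPath ⊗ₘ difference fromFin

    pathTensorComplete-inS : InS (Path t ⊗ Complete (2 ℕ.+ m)) pathTensorComplete
    pathTensorComplete-inS =
      ⊗ₘ-inS signedPath-skewPattern (difference-skewPattern (λ eq → toℕ-injective (fromℕ-injective eq)))

    kernelBasis : Fin (m ℕ.* t) → Vector Carrier (t ℕ.* (2 ℕ.+ m))
    kernelBasis k = unit (blockOf k) ⊗ᵥ columnRelation (relationOf k)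

    kernelBasis-inKernel : ∀ k → InKernel pathTensorComplete (kernelBasis k)
    kernelBasis-inKernel k =
      ⊗-inKernel {signedPath} {difference fromFin} (unit (blockOf k)) {columnRelation (relationOf k)}
        (columnRelation-inKernel (relationOf k))

    kernelBasis-independent : LinearlyIndependent kernelBasis
    kernelBasis-independent = pivots⇒independent kernelBasis pivot diag off
      where
      pivot : Fin (m ℕ.* t) → Fin (t ℕ.* (2 ℕ.+ m))
      pivot k = combine (blockOf k) (suc (suc (relationOf k)))
      at-pivot : ∀ k k′ → kernelBasis k′ (pivot k) ≡
                          unit (blockOf k′) (blockOf k) * unit (relationOf k) (relationOf k′)
      at-pivot k k′ rewrite row-combine (blockOf k) (suc (suc (relationOf k)))
                          | col-combine (blockOf k) (suc (suc (relationOf k))) = refl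
      diag : ∀ k → kernelBasis k (pivot k) ≡ 1#
      diag k = trans (at-pivot k k)
        (trans (cong₂ _*_ (unit-diag (blockOf k)) (unit-diag (relationOf k))) (*-identityˡ 1#))
      off : ∀ k k′ → k′ ≢ k → kernelBasis k′ (pivot k) ≡ 0#
      off k k′ k′≢k with blockOf k′ Fin.≟ blockOf k | relationOf k Fin.≟ relationOf k′
      ... | no b′≢b | _ = trans (at-pivot k k′)
        (trans (cong (_* unit (relationOf k) (relationOf k′)) (unit-off b′≢b)) (zeroˡ _))
      ... | yes _ | no j≢j′ = trans (at-pivot k k′)
        (trans (cong (unit (blockOf k′) (blockOf k) *_) (unit-off j≢j′)) (zeroʳ _))
      ... | yes b′≡b | yes j≡j′ = contradiction (relation-block-injective (sym j≡j′) b′≡b) k′≢k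

    pathTensorComplete-nullity : NullityAtLeast pathTensorComplete (m ℕ.* t)
    pathTensorComplete-nullity = kernelBasis , kernelBasis-inKernel , kernelBasis-independent

-- Zero forcing sets from forcing times

module Chronology {N} (G : Graph N) where
  open import Data.Nat using (_≤_; _<_; _⊔_)

  upperBound : ∀ {k} → (Fin k → ℕ) → ℕ
  upperBound {zero}  f = 0
  upperBound {suc k} f = f zero ⊔ upperBound (f ∘ suc)

  ≤-upperBound : ∀ {k} (f : Fin k → ℕ) i → f i ≤ upperBound f
  ≤-upperBound f zero    = ℕ.m≤m⊔n (f zero) _
  ≤-upperBound f (suc i) = ℕ.≤-trans (≤-upperBound (f ∘ suc) i) (ℕ.m≤n⊔m (f zero) _)

  Forces : (Fin N → ℕ) → Fin N → Fin N → Set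
  Forces κ u w = u ~[ G ] w × κ u < κ w × (∀ v → u ~[ G ] v → v ≢ w → κ v < κ w)

  module _ (κ : Fin N → ℕ) where

    before : ℕ → Subset N
    before K = tabulate (λ v → does (κ v ℕ.<? K))

    ∈before⇔ : ∀ {K v} → v ∈ before K ⇔ κ v < K
    ∈before⇔ {K} {v} = mk⇔ (to (does≡true⇔ (κ v ℕ.<? K)) ∘ to (∈-tabulate⇔ {f = f}))
                           (from (∈-tabulate⇔ {f = f}) ∘ from (does≡true⇔ (κ v ℕ.<? K)))
      where f = λ v → does (κ v ℕ.<? K)

    before-⊤ : ∀ {L} → (∀ v → κ v < L) → before L ≡ ⊤
    before-⊤ κ<L = ⊆-antisym (λ _ → ∈⊤) (λ {v} _ → from ∈before⇔ (κ<L v))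

    ∈before-suc : ∀ {K v} → v ∈ before K → v ∈ before (suc K)
    ∈before-suc {K} v∈ = from ∈before⇔ (ℕ.m<n⇒m<1+n (to (∈before⇔ {K}) v∈))

    ∈before-pred : ∀ {K v} → v ∈ before (suc K) → κ v ≢ K → v ∈ before K
    ∈before-pred {K} v∈ κv≢K =
      from ∈before⇔ (ℕ.≤∧≢⇒< (ℕ.≤-pred (to (∈before⇔ {suc K}) v∈)) κv≢K)

    before-skip : ∀ {K} → (∀ w → κ w ≢ K) → before K ≡ before (suc K)
    before-skip κ≢K = ⊆-antisym ∈before-suc (λ {v} v∈ → ∈before-pred v∈ (κ≢K v))

    before-insert : Injective _≡_ _≡_ κ → ∀ {K w} → κ w ≡ K →
                    before K ∪ ⁅ w ⁆ ≡ before (suc K)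
    before-insert κ-injective {K} {w} κw≡K = ⊆-antisym ⊆ ⊇
      where
      ⊆ : ∀ {v} → v ∈ before K ∪ ⁅ w ⁆ → v ∈ before (suc K)
      ⊆ {v} v∈ with x∈p∪q⁻ (before K) ⁅ w ⁆ v∈
      ... | inj₁ v∈K = ∈before-suc v∈K
      ... | inj₂ v∈w rewrite x∈⁅y⁆⇒x≡y w v∈w =
        from ∈before⇔ (ℕ.≤-reflexive (cong suc κw≡K))
      ⊇ : ∀ {v} → v ∈ before (suc K) → v ∈ before K ∪ ⁅ w ⁆
      ⊇ {v} v∈ with κ v ℕ.≟ K
      ... | yes κv≡K rewrite κ-injective (trans κv≡K (sym κw≡K)) = x∈p∪q⁺ (inj₂ (x∈⁅x⁆ w))
      ... | no κv≢K = x∈p∪q⁺ (inj₁ (∈before-pred v∈ κv≢K))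

    before-step : Injective _≡_ _≡_ κ → ∀ {K} →
                  (∀ w → κ w ≡ K → ∃ λ u → Forces κ u w) →
                  Star (ForceStep G) (before K) (before (suc K))
    before-step κ-injective {K} forcer with any? (λ w → κ w ℕ.≟ K)
    ... | no ∄w = subst (Star (ForceStep G) (before K)) (before-skip (λ w κw≡K → ∄w (w , κw≡K))) ε
    ... | yes (w , κw≡K) with forcer w κw≡K
    ...   | u , u~w , κu<κw , rest-earlier =
      subst (Star (ForceStep G) (before K)) (before-insert κ-injective κw≡K)
        (force u w (from ∈before⇔ (subst (κ u <_) κw≡K κu<κw))
                   (λ w∈ → ℕ.<-irrefl κw≡K (to (∈before⇔ {K}) w∈))
                   u~w only-w ◅ ε)
      where
      only-w : ∀ v → u ~[ G ] v → v ∉ before K → v ≡ w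
      only-w v u~v v∉ with v Fin.≟ w
      ... | yes v≡w = v≡w
      ... | no v≢w =
        contradiction (from ∈before⇔ (subst (κ v <_) κw≡K (rest-earlier v u~v v≢w))) v∉

    before-isZeroForcingSet : Injective _≡_ _≡_ κ → ∀ {K} →
                              (∀ w → K ≤ κ w → ∃ λ u → Forces κ u w) →
                              IsZeroForcingSet G (before K)
    before-isZeroForcingSet κ-injective {K} forcer =
      subst (Star (ForceStep G) (before K)) (before-⊤ bounded) (steps (suc (upperBound κ)))
      where
      steps : ∀ d → Star (ForceStep G) (before K) (before (d ℕ.+ K))
      steps zero    = ε
      steps (suc d) = steps d ◅◅ before-step κ-injective λ w κw≡d+K →
        forcer w (ℕ.≤-trans (ℕ.m≤n+m K d) (ℕ.≤-reflexive (sym κw≡d+K)))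
      bounded : ∀ v → κ v < suc (upperBound κ) ℕ.+ K
      bounded v = ℕ.≤-trans (s≤s (≤-upperBound κ v)) (ℕ.m≤m+n _ K)

  module _ (τ : Fin N → ℕ) where

    -- A force colours one vertex, so vertices of equal time are ordered by their index.
    tieBreak : Fin N → ℕ
    tieBreak v = N ℕ.* τ v ℕ.+ toℕ v

    tieBreak-< : ∀ {u w} → τ u < τ w → tieBreak u < tieBreak w
    tieBreak-< {u} {w} τu<τw = begin-strict
      N ℕ.* τ u ℕ.+ toℕ u   <⟨ ℕ.+-monoʳ-< (N ℕ.* τ u) (toℕ<n u) ⟩
      N ℕ.* τ u ℕ.+ N       ≡⟨ ℕ.+-comm (N ℕ.* τ u) N ⟩
      N ℕ.+ N ℕ.* τ u       ≡⟨ ℕ.*-suc N (τ u) ⟨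
      N ℕ.* suc (τ u)       ≤⟨ ℕ.*-monoʳ-≤ N τu<τw ⟩
      N ℕ.* τ w             ≤⟨ ℕ.m≤m+n (N ℕ.* τ w) (toℕ w) ⟩
      N ℕ.* τ w ℕ.+ toℕ w   ∎
      where open ℕ.≤-Reasoning

    tieBreak-injective : Injective _≡_ _≡_ tieBreak
    tieBreak-injective {u} {w} eq with ℕ.<-cmp (τ u) (τ w)
    ... | tri< τu<τw _ _ = contradiction eq (ℕ.<⇒≢ (tieBreak-< τu<τw))
    ... | tri> _ _ τw<τu = contradiction (sym eq) (ℕ.<⇒≢ (tieBreak-< τw<τu))
    ... | tri≈ _ τu≡τw _ = toℕ-injective (ℕ.+-cancelˡ-≡ (N ℕ.* τ u) _ _
                             (trans eq (cong (λ a → N ℕ.* a ℕ.+ toℕ w) (sym τu≡τw))))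

    tieBreak<N⇔ : ∀ {v} → tieBreak v < N ⇔ τ v < 1
    tieBreak<N⇔ {v} = mk⇔ ⇒ ⇐
      where
      ⇒ : tieBreak v < N → τ v < 1
      ⇒ κv<N with τ v
      ... | zero  = s≤s z≤n
      ... | suc k = contradiction κv<N (ℕ.≤⇒≯ (begin
        N                      ≡⟨ ℕ.*-identityʳ N ⟨
        N ℕ.* 1                ≤⟨ ℕ.*-monoʳ-≤ N (s≤s z≤n) ⟩
        N ℕ.* suc k            ≤⟨ ℕ.m≤m+n _ (toℕ v) ⟩
        N ℕ.* suc k ℕ.+ toℕ v  ∎))
        where open ℕ.≤-Reasoning
      ⇐ : τ v < 1 → tieBreak v < N
      ⇐ τv<1 rewrite ℕ.n<1⇒n≡0 τv<1 | ℕ.*-zeroʳ N = toℕ<n v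

    zeroTime-isZeroForcingSet : (∀ w → 0 < τ w → ∃ λ u → Forces τ u w) →
                                IsZeroForcingSet G (before τ 1)
    zeroTime-isZeroForcingSet forcer = subst (IsZeroForcingSet G) before-tieBreak
      (before-isZeroForcingSet tieBreak tieBreak-injective λ w N≤κw →
        refine (forcer w (positive N≤κw)))
      where
      before-tieBreak : before tieBreak N ≡ before τ 1
      before-tieBreak = ⊆-antisym
        (λ v∈ → from (∈before⇔ τ) (to tieBreak<N⇔ (to (∈before⇔ tieBreak) v∈)))
        (λ v∈ → from (∈before⇔ tieBreak) (from tieBreak<N⇔ (to (∈before⇔ τ) v∈)))
      positive : ∀ {w} → N ≤ tieBreak w → 0 < τ w
      positive N≤κw = ℕ.≮⇒≥ (λ τw<1 → ℕ.≤⇒≯ N≤κw (from tieBreak<N⇔ τw<1))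
      refine : ∀ {w} → ∃ (λ u → Forces τ u w) → ∃ (λ u → Forces tieBreak u w)
      refine (u , u~w , τu<τw , rest-earlier) =
        u , u~w , tieBreak-< τu<τw , λ v u~v v≢w → tieBreak-< (rest-earlier v u~v v≢w)

module GridForcing (t n : ℕ) (time : ℕ → Fin n → ℕ) where
  open import Data.Nat using (_<_)
  open Grid t n
  open Chronology (Path t ⊗ Complete n)

  record Forcer (r : ℕ) (h : Fin n) : Set where
    field
      r′        : ℕ
      h′        : Fin n
      r′<t      : r′ < t
      adjacent  : Adjacentℕ r′ r
      distinct  : h′ ≢ h
      earlier   : time r′ h′ < time r h
      neighbours-earlier : ∀ r″ h″ → r″ < t → Adjacentℕ r′ r″ → h′ ≢ h″ →
                           (r″ ≡ r → h″ ≢ h) → time r″ h″ < time r h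

  gridTime : Fin (t ℕ.* n) → ℕ
  gridTime x = time (toℕ (row x)) (col x)

  forcer⇒forces : ∀ x → Forcer (toℕ (row x)) (col x) → ∃ λ u → Forces gridTime u x
  forcer⇒forces x f =
    u , u~x , subst (_< gridTime x) (sym (cong₂ time row-u col-u)) earlier , neighbours
    where
    open Forcer f
    u = combine (fromℕ< r′<t) h′
    row-u : toℕ (row u) ≡ r′
    row-u = trans (cong toℕ (row-combine (fromℕ< r′<t) h′)) (toℕ-fromℕ< r′<t)
    col-u : col u ≡ h′
    col-u = col-combine (fromℕ< r′<t) h′
    u~x : u ~[ Path t ⊗ Complete n ] x
    u~x = from (⊗-adjacent⇔ {G = Path t} {Complete n} {u} {x})
      ( from path-adjacent⇔ (subst (λ r → Adjacentℕ r (toℕ (row x))) (sym row-u) adjacent)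
      , from complete-adjacent⇔ (subst (_≢ col x) (sym col-u) distinct))
    neighbours : ∀ v → u ~[ Path t ⊗ Complete n ] v → v ≢ x → gridTime v < gridTime x
    neighbours v u~v v≢x with to (⊗-adjacent⇔ {G = Path t} {Complete n} {u} {v}) u~v
    ... | ru~rv , cu~cv = neighbours-earlier (toℕ (row v)) (col v) (toℕ<n (row v))
      (subst (λ r → Adjacentℕ r (toℕ (row v))) row-u (to path-adjacent⇔ ru~rv))
      (subst (_≢ col v) col-u (to complete-adjacent⇔ cu~cv))
      (λ rv≡rx cv≡cx → v≢x (row-col-injective (toℕ-injective rv≡rx) cv≡cx))

-- A zero forcing set of size (n − 2) t in P_t × K_n for even t

module EvenPathTensorComplete (t m : ℕ) (t-even : parity t ≡ 0ℙ) (0<t : 0 ℕ.< t) where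
  open import Data.Nat using (_≤_; _<_; _+_; _∸_)

  down : ℕ → ℕ
  down r = t + (t ∸ r)

  0<down : ∀ r → 0 < down r
  0<down r = ℕ.≤-trans 0<t (ℕ.m≤m+n t (t ∸ r))

  down-< : ∀ {r} → suc (suc r) ≤ t → down (suc (suc r)) < down r
  down-< {r} r+2≤t = ℕ.+-monoʳ-< t (ℕ.∸-monoʳ-< (ℕ.m<n⇒m<1+n (ℕ.n<1+n r)) r+2≤t)

  0<2t+ : ∀ {x} → 0 < x → 0 < (t + t) + x
  0<2t+ {x} 0<x = ℕ.≤-trans 0<x (ℕ.m≤n+m x (t + t))

  -- The time at which vertex (r, h) turns blue.  Sweeps 1 and 3 climb the odd rows at times suc r and
  -- 2t + suc r; sweeps 2 and 4 descend the even rows at times down r ∈ (t, 2t] and 2t + down r.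
  timeAt : Parity → ℕ → Fin (3 + m) → ℕ
  timeAt 0ℙ r 0F = (t + t) + down r
  timeAt 1ℙ r 0F = 0
  timeAt 0ℙ r 1F = down r
  timeAt 1ℙ r 1F = suc r
  timeAt 0ℙ r 2F = 0
  timeAt 1ℙ r 2F = (t + t) + suc r
  timeAt _  r (suc (suc (suc _))) = 0

  time : ℕ → Fin (3 + m) → ℕ
  time r = timeAt (parity r) r

  open GridForcing t (3 + m) time using (Forcer)

  forcerVia : ∀ {r h} r′ h′ {p p′} → parity r ≡ p → parity r′ ≡ p′ →
              r′ < t → Adjacentℕ r′ r → h′ ≢ h → timeAt p′ r′ h′ < timeAt p r h →
              (∀ r″ h″ → r″ < t → Adjacentℕ r′ r″ → h′ ≢ h″ →
                 (r″ ≡ r → h″ ≢ h) → timeAt (p′ ⁻¹) r″ h″ < timeAt p r h) →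
              Forcer r h
  forcerVia {r} {h} r′ h′ parity-r parity-r′ r′<t adj h′≢h earlier later = record
    { r′ = r′ ; h′ = h′ ; r′<t = r′<t ; adjacent = adj ; distinct = h′≢h
    ; earlier = subst₂ _<_ (sym (time≡ parity-r′)) (sym (time≡ parity-r)) earlier
    ; neighbours-earlier = λ r″ h″ r″<t adj′ h′≢h″ not-w →
        subst₂ _<_ (sym (time≡ (trans (parity-adjacent adj′) (cong _⁻¹ parity-r′))))
                   (sym (time≡ parity-r))
                   (later r″ h″ r″<t adj′ h′≢h″ not-w) }
    where
    time≡ : ∀ {r h p} → parity r ≡ p → time r h ≡ timeAt p r h
    time≡ {r} {h} = cong (λ p → timeAt p r h)

  sweep₁-neighbours : ∀ r₀ r″ h″ → r″ < t → Adjacentℕ r₀ r″ → 2F ≢ h″ →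
                      (r″ ≡ suc r₀ → h″ ≢ 1F) → timeAt 1ℙ r″ h″ < suc (suc r₀)
  sweep₁-neighbours _ _  0F _ _           _     _     = s≤s z≤n
  sweep₁-neighbours _ r″ 1F _ (inj₁ refl) _     _     = ℕ.m<n⇒m<1+n (ℕ.n<1+n (suc r″))
  sweep₁-neighbours _ _  1F _ (inj₂ refl) _     not-w = contradiction refl (not-w refl)
  sweep₁-neighbours _ _  2F _ _           2F≢2F _     = contradiction refl 2F≢2F
  sweep₁-neighbours _ _  (suc (suc (suc _))) _ _ _ _ = s≤s z≤n

  sweep₂-neighbours : ∀ r r″ h″ → r″ < t → Adjacentℕ (suc r) r″ → 0F ≢ h″ →
                      (r″ ≡ r → h″ ≢ 1F) → timeAt 0ℙ r″ h″ < down r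
  sweep₂-neighbours _ _ 0F _    _           0F≢0F _     = contradiction refl 0F≢0F
  sweep₂-neighbours _ _ 1F _    (inj₁ refl) _     not-w = contradiction refl (not-w refl)
  sweep₂-neighbours _ _ 1F r″<t (inj₂ refl) _     _     = down-< (ℕ.<⇒≤ r″<t)
  sweep₂-neighbours r _ 2F _    _           _     _     = 0<down r
  sweep₂-neighbours r _ (suc (suc (suc _))) _ _ _ _ = 0<down r

  sweep₃-neighbours : ∀ r₀ r″ h″ → r″ < t → Adjacentℕ r₀ r″ → 1F ≢ h″ →
                      (r″ ≡ suc r₀ → h″ ≢ 2F) → timeAt 1ℙ r″ h″ < (t + t) + suc (suc r₀)
  sweep₃-neighbours _ _  0F _ _           _     _     = 0<2t+ (s≤s z≤n)
  sweep₃-neighbours _ _  1F _ _           1F≢1F _     = contradiction refl 1F≢1F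
  sweep₃-neighbours _ r″ 2F _ (inj₁ refl) _     _     = ℕ.+-monoʳ-< (t + t) (ℕ.m<n⇒m<1+n (ℕ.n<1+n _))
  sweep₃-neighbours _ _  2F _ (inj₂ refl) _     not-w = contradiction refl (not-w refl)
  sweep₃-neighbours _ _  (suc (suc (suc _))) _ _ _ _ = 0<2t+ (s≤s z≤n)

  sweep₄-neighbours : ∀ r r″ h″ → r″ < t → Adjacentℕ (suc r) r″ → 1F ≢ h″ →
                      (r″ ≡ r → h″ ≢ 0F) → timeAt 0ℙ r″ h″ < (t + t) + down r
  sweep₄-neighbours _ _ 0F _    (inj₁ refl) _     not-w = contradiction refl (not-w refl)
  sweep₄-neighbours _ _ 0F r″<t (inj₂ refl) _     _     = ℕ.+-monoʳ-< (t + t) (down-< (ℕ.<⇒≤ r″<t))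
  sweep₄-neighbours _ _ 1F _    _           1F≢1F _     = contradiction refl 1F≢1F
  sweep₄-neighbours r _ 2F _    _           _     _     = 0<2t+ (0<down r)
  sweep₄-neighbours r _ (suc (suc (suc _))) _ _ _ _ = 0<2t+ (0<down r)

  forcerAt : ∀ p {r} → parity r ≡ p → ∀ h → r < t → 0 < timeAt p r h → Forcer r h
  forcerAt 1ℙ {suc r₀} odd-r 1F r<t _ =
    forcerVia r₀ 2F odd-r (odd[1+n]⇒even[n] {r₀} odd-r) (ℕ.<-trans (ℕ.n<1+n r₀) r<t)
      (inj₂ refl) (λ ()) (s≤s z≤n) (sweep₁-neighbours r₀)
  forcerAt 0ℙ {r} even-r 1F r<t _ =
    forcerVia (suc r) 0F even-r (even[n]⇒odd[1+n] {r} even-r) (even<even⇒1+< even-r t-even r<t)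
      (inj₁ refl) (λ ()) (0<down r) (sweep₂-neighbours r)
  forcerAt 1ℙ {suc r₀} odd-r 2F r<t _ =
    forcerVia r₀ 1F odd-r (odd[1+n]⇒even[n] {r₀} odd-r) (ℕ.<-trans (ℕ.n<1+n r₀) r<t)
      (inj₂ refl) (λ ()) down<2t+ (sweep₃-neighbours r₀)
    where down<2t+ = ℕ.≤-<-trans (ℕ.+-monoʳ-≤ t (ℕ.m∸n≤m t r₀)) (ℕ.m<m+n (t + t) (s≤s z≤n))
  forcerAt 0ℙ {r} even-r 0F r<t _ =
    forcerVia (suc r) 1F even-r (even[n]⇒odd[1+n] {r} even-r) r+1<t
      (inj₁ refl) (λ ()) r+2<2t+ (sweep₄-neighbours r)
    where
    r+1<t = even<even⇒1+< even-r t-even r<t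
    r+2<2t+ = ℕ.≤-<-trans (ℕ.≤-trans r+1<t (ℕ.m≤m+n t t)) (ℕ.m<m+n (t + t) (0<down r))
  forcerAt 1ℙ {zero} () _ _ _
  forcerAt 1ℙ _ 0F _ ()
  forcerAt 0ℙ _ 2F _ ()
  forcerAt 1ℙ _ (suc (suc (suc _))) _ ()
  forcerAt 0ℙ _ (suc (suc (suc _))) _ ()

  open Grid t (3 + m)
  open GridForcing t (3 + m) time using (gridTime; forcer⇒forces)
  open Chronology (Path t ⊗ Complete (3 + m)) using (before; zeroTime-isZeroForcingSet)

  initiallyBlue : Subset (t ℕ.* (3 + m))
  initiallyBlue = before gridTime 1

  initiallyBlue-isZeroForcingSet : IsZeroForcingSet (Path t ⊗ Complete (3 + m)) initiallyBlue
  initiallyBlue-isZeroForcingSet = zeroTime-isZeroForcingSet gridTime λ x 0<τx →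
    forcer⇒forces x (forcerAt (parity (toℕ (row x))) refl (col x) (toℕ<n (row x)) 0<τx)

  ∣initiallyBlue∣ : ∣ initiallyBlue ∣ ≡ t ℕ.* suc m
  ∣initiallyBlue∣ = ∣tabulate∣-rows t (3 + m) (λ g h → does (time (toℕ g) h ℕ.<? 1))
                      (λ g → blue-per-row (parity (toℕ g)) (toℕ g))
    where
    positive⇒white : ∀ {x} → 0 < x → does (x ℕ.<? 1) ≡ false
    positive⇒white 0<x = dec-false (_ ℕ.<? 1) (ℕ.≤⇒≯ 0<x)
    blue-per-row : ∀ p r → ∣ tabulate (λ h → does (timeAt p r h ℕ.<? 1)) ∣ ≡ suc m
    blue-per-row 1ℙ r rewrite positive⇒white (0<2t+ {suc r} (s≤s z≤n)) =
      cong suc (∣tabulate[true]∣ m)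
    blue-per-row 0ℙ r rewrite positive⇒white (0<2t+ (0<down r)) | positive⇒white (0<down r) =
      cong suc (∣tabulate[true]∣ m)

open import Data.Nat using (ℕ; _≤_; _∸_; _*_)
open import Data.Nat.Divisibility using (_∣_; divides)

theorem2p4 : (ℝ : RealField) (t n : ℕ) → 2 ∣ t → 2 ≤ t → 3 ≤ n →
    Nullity.MaxNullityIs ℝ (Path t ⊗ Complete n) ((n ∸ 2) * t) ×
    ZeroForcingNumberIs (Path t ⊗ Complete n) ((n ∸ 2) * t)
theorem2p4 ℝ t (suc (suc (suc m))) (divides q t≡q*2) 2≤t (s≤s (s≤s (s≤s z≤n))) =
  ( (A , A∈S , nullity[A])
  , λ A′ A′∈S k nullity[A′] →
      subst (k ≤_) ∣B∣≡ (maxNullity≤zeroForcing A′∈S nullity[A′] B-forces))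
  , ( (B , B-forces , ∣B∣≡)
    , λ B′ B′-forces → maxNullity≤zeroForcing A∈S nullity[A] B′-forces)
  where
  open Construction ℝ
  open LinearAlgebra ℝ using (maxNullity≤zeroForcing)
  open EvenPathTensorComplete t m
         (trans (cong parity t≡q*2) (parity[n*2]≡0ℙ q)) (ℕ.≤-trans (s≤s z≤n) 2≤t)
  A = pathTensorComplete t (suc m)
  A∈S = pathTensorComplete-inS t (suc m)
  nullity[A] = pathTensorComplete-nullity t (suc m)
  B = initiallyBlue
  B-forces = initiallyBlue-isZeroForcingSet
  ∣B∣≡ : ∣ B ∣ ≡ suc m * t
  ∣B∣≡ = trans ∣initiallyBlue∣ (ℕ.*-comm t (suc m))
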